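{- Let $\varphi$ and $\psi$ be expressions in the variables $x_1,\ldots,x_n$, and suppose there is a term $\gamma$ of $\mathcal{M}(\varphi)_{imp}$ such that no subterm of $\gamma$ is a term of $\mathcal{M}(\psi)_{imp}$. Then there exists a valuation $v$ of $x_1,\ldots,x_n$ in $\mathrm{M}$ such that $\llbracket\varphi\rrbracket_v>0$ and $\llbracket\varphi\rrbracket_v>\llbracket\psi\rrbracket_v$.
   Context: $\mathrm{M}$ denotes $\widehat{\mathbb{Z}}=(\mathbb{Z}\setminus\{0\})\cup\{ -\infty,\infty\}$ with $\land=\min$, $\lor=\max$, $\lnot a=-a$. An expression is a propositional formula built from variables with $\land,\lor,\lnot$ (no constants); a valuation $v$ assigns each variable a value in $\mathrm{M}$ and $\llbracket\varphi\rrbracket_v\in\mathrm{M}$ is the resulting value. A literal is a variable $x$ or its negation $\bar x$; a (conjunctive) term is a conjunction of literals, identified with its set of literals, and a subterm of a term is a term whose literals form a subset of its literals. The De Morgan Canonical Form $\mathcal{M}(\varphi)$ is the unique (up to reordering) expression obtained from $\varphi$ using only the laws of De Morgan algebras (commutativity, associativity, idempotence, absorption, distributivity, double negation, De Morgan laws) which is in disjunctive normal form, in which no term contains the same literal twice, and in which no term is a subterm of another term (so terms like $x\bar x$ are not removed). $\mathcal{M}(\varphi)_{imp}$ is the disjunction of those terms of $\mathcal{M}(\varphi)$ containing no pair $x,\bar x$ (implicant terms), and $\mathcal{M}(\varphi)_{cont}$ is the disjunction of the remaining (contradictory) terms, so $\mathcal{M}(\varphi)=\mathcal{M}(\varphi)_{imp}\lor\mathcal{M}(\varphi)_{cont}$.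 Note $\llbracket\varphi\rrbracket_v=\llbracket\mathcal{M}(\varphi)\rrbracket_v$ for every valuation $v$ in $\mathrm{M}$. -}

module Defs where

open import Data.Nat using (ℕ; zero; suc) renaming (_<_ to _<ℕ_; _<ᵇ_ to _<ᵇℕ_; _≡ᵇ_ to _≡ᵇℕ_)
open import Data.Fin using (Fin; toℕ)
open import Data.Bool using (Bool; true; false; not; _∧_; _∨_; if_then_else_)
open import Data.List using (List; []; _∷_; _++_; map; concatMap; filter)
open import Data.Bool.ListAction using (any; all)
open import Data.Product using (_×_; _,_; proj₁; proj₂)
open import Relation.Nullary.Decidable using (yes; no)
open import Data.Bool using (T)
open import Data.Bool.Properties using (T?)

-- The algebra M = (ℤ ∖ {0}) ∪ {-∞, +∞}
-- neg k represents -(k+1), pos k represents k+1.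

data M : Set where
  -∞  : M
  neg : ℕ → M
  pos : ℕ → M
  +∞  : M

infix 4 _<M_
infix 10 ⟦_⟧_
data _<M_ : M → M → Set where
  -∞<neg : ∀ {n} → -∞ <M neg n
  -∞<pos : ∀ {n} → -∞ <M pos n
  -∞<+∞  : -∞ <M +∞
  neg<neg : ∀ {m n} → n <ℕ m → neg m <M neg n
  neg<pos : ∀ {m n} → neg m <M pos n
  neg<+∞  : ∀ {m} → neg m <M +∞
  pos<pos : ∀ {m n} → m <ℕ n → pos m <M pos n
  pos<+∞  : ∀ {m} → pos m <M +∞

_≤ᵇM_ : M → M → Bool
-∞    ≤ᵇM _     = true
neg _ ≤ᵇM -∞    = false
neg m ≤ᵇM neg n = (n <ᵇℕ m) ∨ (n ≡ᵇℕ m)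
neg _ ≤ᵇM pos _ = true
neg _ ≤ᵇM +∞    = true
pos _ ≤ᵇM -∞    = false
pos _ ≤ᵇM neg _ = false
pos m ≤ᵇM pos n = (m <ᵇℕ n) ∨ (m ≡ᵇℕ n)
pos _ ≤ᵇM +∞    = true
+∞    ≤ᵇM +∞    = true
+∞    ≤ᵇM _     = false

minM : M → M → M
minM a b = if a ≤ᵇM b then a else b

maxM : M → M → M
maxM a b = if a ≤ᵇM b then b else a

negM : M → M
negM -∞      = +∞
negM (neg n) = pos n
negM (pos n) = neg n
negM +∞      = -∞

data Positive : M → Set where
  pos>0 : ∀ {n} → Positive (pos n)
  +∞>0  : Positive +∞

infixr 6 _∧ₑ_
infixr 5 _∨ₑ_
infix 7 ¬ₑ_

data Expr (n : ℕ) : Set where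
  var  : Fin n → Expr n
  _∧ₑ_ : Expr n → Expr n → Expr n
  _∨ₑ_ : Expr n → Expr n → Expr n
  ¬ₑ_  : Expr n → Expr n

Valuation : ℕ → Set
Valuation n = Fin n → M

⟦_⟧_ : ∀ {n} → Expr n → Valuation n → M
⟦ var x ⟧ v   = v x
⟦ e ∧ₑ f ⟧ v  = minM (⟦ e ⟧ v) (⟦ f ⟧ v)
⟦ e ∨ₑ f ⟧ v  = maxM (⟦ e ⟧ v) (⟦ f ⟧ v)
⟦ ¬ₑ e ⟧ v    = negM (⟦ e ⟧ v)

-- Literals and terms.  A literal (x , b): b = false is x, b = true is x̄.

Lit : ℕ → Set
Lit n = Fin n × Bool

Term : ℕ → Set
Term n = List (Lit n)

DNF : ℕ → Set
DNF n = List (Term n)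

_≡ᵇLit_ : ∀ {n} → Lit n → Lit n → Bool
(x , a) ≡ᵇLit (y , b) = (toℕ x ≡ᵇℕ toℕ y) ∧ eqB a b
  where
  eqB : Bool → Bool → Bool
  eqB true true = true
  eqB false false = true
  eqB _ _ = false

elemᵇ : ∀ {n} → Lit n → Term n → Bool
elemᵇ l t = any (l ≡ᵇLit_) t

subᵇ : ∀ {n} → Term n → Term n → Bool
subᵇ s t = all (λ l → elemᵇ l t) s

sameᵇ : ∀ {n} → Term n → Term n → Bool
sameᵇ s t = subᵇ s t ∧ subᵇ t s

nubLit : ∀ {n} → Term n → Term n
nubLit [] = []
nubLit (l ∷ t) = if elemᵇ l t then nubLit t else l ∷ nubLit t

nubTerm : ∀ {n} → DNF n → DNF n
nubTerm [] = []
nubTerm (t ∷ d) = if any (sameᵇ t) d then nubTerm d else t ∷ nubTerm d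

-- naive DNF (all disjuncts); polarity b = true means the expression is negated
dnf : ∀ {n} → Bool → Expr n → DNF n
dnf b (var x)  = ((x , b) ∷ []) ∷ []
dnf b (¬ₑ e)   = dnf (not b) e
dnf false (e ∧ₑ f) = concatMap (λ s → map (s ++_) (dnf false f)) (dnf false e)
dnf true  (e ∧ₑ f) = dnf true e ++ dnf true f
dnf false (e ∨ₑ f) = dnf false e ++ dnf false f
dnf true  (e ∨ₑ f) = concatMap (λ s → map (s ++_) (dnf true f)) (dnf true e)

absorb : ∀ {n} → DNF n → DNF n
absorb d = filter (λ t → T? (not (any (λ s → subᵇ s t ∧ not (subᵇ t s)) d))) d

𝓜 : ∀ {n} → Expr n → DNF n
𝓜 φ = absorb (nubTerm (map nubLit (dnf false φ)))

contrᵇ : ∀ {n} → Term n → Bool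
contrᵇ t = any (λ { (x , b) → elemᵇ (x , not b) t }) t

𝓜imp : ∀ {n} → Expr n → DNF n
𝓜imp φ = filter (λ t → T? (not (contrᵇ t))) (𝓜 φ)

-- Let v send x to 2 if x ∈ γ, to -2 if x̄ ∈ γ and to 1 otherwise; this is well defined
-- because γ is not contradictory.  The tests a ≥ 2 and a ≤ -2 turn min and max into ∧ and ∨
-- and are exchanged by negation, so ⟦ φ ⟧ v ≥ 2 holds exactly when the naive DNF of φ is true
-- under the Boolean assignment making precisely the literals of γ true, i.e. when some term of
-- it is contained in γ.  The term γ of 𝓜(φ) comes from such a term, so ⟦ φ ⟧ v ≥ 2 > 0.  If
-- ⟦ ψ ⟧ v ≥ 2, a DNF term of ψ lies in γ, and so does a term of 𝓜(ψ) below it, which is then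
-- not contradictory either: this contradicts the hypothesis.  So ⟦ ψ ⟧ v ≤ 1 < ⟦ φ ⟧ v.
module Submission where

open import Defs
open import Data.Nat using (ℕ)
open import Data.Product using (Σ; _×_)
open import Data.List.Membership.Propositional using (_∈_)
open import Data.List.Relation.Binary.Subset.Propositional using (_⊆_)
open import Relation.Nullary using (¬_)

open import Data.Bool using (Bool; true; false; not; _∧_; _∨_; if_then_else_; T)
open import Data.Bool.ListAction using (and; or; any; all)
open import Data.Bool.Properties
  using (T?; T-∧; if-float; ∧-assoc; ∨-assoc; ∧-zeroʳ; ∨-zeroʳ; ∧-identityʳ; ∨-identityʳ; ∧-distribˡ-∨; ∧-distribʳ-∨)
open import Data.Empty using (⊥-elim)
open import Data.Fin using (toℕ)
open import Data.Fin.Properties using (toℕ-injective)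
open import Data.List using ([]; _∷_; _++_; map; concatMap)
open import Data.List.Properties using (map-cong)
open import Data.List.Membership.Propositional using (find; lose)
open import Data.List.Membership.Propositional.Properties using (∈-filter⁺; ∈-filter⁻; ∈-map⁺; ∈-map⁻)
open import Data.List.Relation.Binary.Subset.Propositional.Properties using (⊆-refl; ⊆-trans)
open import Data.List.Relation.Unary.All as All using ()
open import Data.List.Relation.Unary.All.Properties using (all⁺; all⁻)
open import Data.List.Relation.Unary.Any as Any using (here; there)
open import Data.List.Relation.Unary.Any.Properties using (any⁺; any⁻)
open import Data.Nat using (zero; suc; _<ᵇ_; _≡ᵇ_; _⊓_; _⊔_; z≤n; s≤s)
open import Data.Nat.Properties using (≡ᵇ⇒≡; ≡⇒≡ᵇ; ⊓-comm; ⊔-comm)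
open import Data.Product using (_,_; proj₁; proj₂; ∃-syntax)
open import Function using (_∘_; _⇔_; mk⇔; Equivalence)
open import Relation.Binary.PropositionalEquality using (_≡_; refl; sym; trans; cong; cong₂; subst)
open import Relation.Nullary using (yes; no)

private
  variable
    n : ℕ

T-not : ∀ {b} → T (not b) ⇔ (¬ T b)
T-not {false} = mk⇔ (λ _ ()) _
T-not {true}  = mk⇔ (λ ()) (λ ¬t → ¬t _)

-- The test by which _≤ᵇM_ compares pos m with pos n, and neg n with neg m.
select-⊓ : ∀ m n → (if (m <ᵇ n) ∨ (m ≡ᵇ n) then m else n) ≡ m ⊓ n
select-⊓ zero    zero    = refl
select-⊓ zero    (suc n) = refl
select-⊓ (suc m) zero    = refl
select-⊓ (suc m) (suc n) = trans (sym (if-float suc ((m <ᵇ n) ∨ (m ≡ᵇ n)))) (cong suc (select-⊓ m n))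

select-⊔ : ∀ m n → (if (m <ᵇ n) ∨ (m ≡ᵇ n) then n else m) ≡ m ⊔ n
select-⊔ zero    zero    = refl
select-⊔ zero    (suc n) = refl
select-⊔ (suc m) zero    = refl
select-⊔ (suc m) (suc n) = trans (sym (if-float suc ((m <ᵇ n) ∨ (m ≡ᵇ n)))) (cong suc (select-⊔ m n))

minM-pos : ∀ m n → minM (pos m) (pos n) ≡ pos (m ⊓ n)
minM-pos m n = trans (sym (if-float pos ((m <ᵇ n) ∨ (m ≡ᵇ n)))) (cong pos (select-⊓ m n))

maxM-pos : ∀ m n → maxM (pos m) (pos n) ≡ pos (m ⊔ n)
maxM-pos m n = trans (sym (if-float pos ((m <ᵇ n) ∨ (m ≡ᵇ n)))) (cong pos (select-⊔ m n))

minM-neg : ∀ m n → minM (neg m) (neg n) ≡ neg (m ⊔ n)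
minM-neg m n = trans (sym (if-float neg ((n <ᵇ m) ∨ (n ≡ᵇ m)))) (cong neg (trans (select-⊔ n m) (⊔-comm n m)))

maxM-neg : ∀ m n → maxM (neg m) (neg n) ≡ neg (m ⊓ n)
maxM-neg m n = trans (sym (if-float neg ((n <ᵇ m) ∨ (n ≡ᵇ m)))) (cong neg (trans (select-⊓ n m) (⊓-comm n m)))

negM-involutive : ∀ a → negM (negM a) ≡ a
negM-involutive -∞      = refl
negM-involutive (neg _) = refl
negM-involutive (pos _) = refl
negM-involutive +∞      = refl

-- high a and low a decide 2 ≤ a and a ≤ -2 (pos k encodes k + 1, neg k encodes -(k + 1)).
high : M → Bool
high (pos (suc _)) = true
high +∞            = true
high _             = false

low : M → Bool
low a = high (negM a)

high-pos-⊓ : ∀ m n → high (pos (m ⊓ n)) ≡ high (pos m) ∧ high (pos n)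
high-pos-⊓ zero    n       = refl
high-pos-⊓ (suc m) zero    = refl
high-pos-⊓ (suc m) (suc n) = refl

high-pos-⊔ : ∀ m n → high (pos (m ⊔ n)) ≡ high (pos m) ∨ high (pos n)
high-pos-⊔ zero    n       = refl
high-pos-⊔ (suc m) zero    = refl
high-pos-⊔ (suc m) (suc n) = refl

high-minM : ∀ a b → high (minM a b) ≡ high a ∧ high b
high-minM -∞      b       = refl
high-minM (neg m) -∞      = refl
high-minM (neg m) (neg n) = cong high (minM-neg m n)
high-minM (neg m) (pos n) = refl
high-minM (neg m) +∞      = refl
high-minM (pos m) -∞      = sym (∧-zeroʳ _)
high-minM (pos m) (neg n) = sym (∧-zeroʳ _)
high-minM (pos m) (pos n) = trans (cong high (minM-pos m n)) (high-pos-⊓ m n)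
high-minM (pos m) +∞      = sym (∧-identityʳ _)
high-minM +∞      -∞      = refl
high-minM +∞      (neg n) = refl
high-minM +∞      (pos n) = refl
high-minM +∞      +∞      = refl

high-maxM : ∀ a b → high (maxM a b) ≡ high a ∨ high b
high-maxM -∞      b       = refl
high-maxM (neg m) -∞      = refl
high-maxM (neg m) (neg n) = cong high (maxM-neg m n)
high-maxM (neg m) (pos n) = refl
high-maxM (neg m) +∞      = refl
high-maxM (pos m) -∞      = sym (∨-identityʳ _)
high-maxM (pos m) (neg n) = sym (∨-identityʳ _)
high-maxM (pos m) (pos n) = trans (cong high (maxM-pos m n)) (high-pos-⊔ m n)
high-maxM (pos m) +∞      = sym (∨-zeroʳ _)
high-maxM +∞      -∞      = refl
high-maxM +∞      (neg n) = refl
high-maxM +∞      (pos n) = refl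
high-maxM +∞      +∞      = refl

low-minM : ∀ a b → low (minM a b) ≡ low a ∨ low b
low-minM -∞      b       = refl
low-minM (neg m) -∞      = sym (∨-zeroʳ _)
low-minM (neg m) (neg n) = trans (cong low (minM-neg m n)) (high-pos-⊔ m n)
low-minM (neg m) (pos n) = sym (∨-identityʳ _)
low-minM (neg m) +∞      = sym (∨-identityʳ _)
low-minM (pos m) -∞      = refl
low-minM (pos m) (neg n) = refl
low-minM (pos m) (pos n) = cong low (minM-pos m n)
low-minM (pos m) +∞      = refl
low-minM +∞      -∞      = refl
low-minM +∞      (neg n) = refl
low-minM +∞      (pos n) = refl
low-minM +∞      +∞      = refl

low-maxM : ∀ a b → low (maxM a b) ≡ low a ∧ low b
low-maxM -∞      b       = refl
low-maxM (neg m) -∞      = sym (∧-identityʳ _)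
low-maxM (neg m) (neg n) = trans (cong low (maxM-neg m n)) (high-pos-⊓ m n)
low-maxM (neg m) (pos n) = sym (∧-zeroʳ _)
low-maxM (neg m) +∞      = sym (∧-zeroʳ _)
low-maxM (pos m) -∞      = refl
low-maxM (pos m) (neg n) = refl
low-maxM (pos m) (pos n) = cong low (maxM-pos m n)
low-maxM (pos m) +∞      = refl
low-maxM +∞      -∞      = refl
low-maxM +∞      (neg n) = refl
low-maxM +∞      (pos n) = refl
low-maxM +∞      +∞      = refl

high⇒Positive : ∀ {a} → T (high a) → Positive a
high⇒Positive {pos (suc _)} _ = pos>0
high⇒Positive {+∞}          _ = +∞>0

¬high<high : ∀ {a b} → ¬ T (high a) → T (high b) → a <M b
¬high<high { -∞}         {pos (suc _)} _ _ = -∞<pos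
¬high<high { -∞}         {+∞}          _ _ = -∞<+∞
¬high<high {neg _}       {pos (suc _)} _ _ = neg<pos
¬high<high {neg _}       {+∞}          _ _ = neg<+∞
¬high<high {pos zero}    {pos (suc _)} _ _ = pos<pos (s≤s z≤n)
¬high<high {pos zero}    {+∞}          _ _ = pos<+∞
¬high<high {pos (suc _)} a≱2           _   = ⊥-elim (a≱2 _)
¬high<high {+∞}          a≱2           _   = ⊥-elim (a≱2 _)

module _ {A : Set} (p : A → Bool) where

  any-++ : ∀ xs ys → any p (xs ++ ys) ≡ any p xs ∨ any p ys
  any-++ []       ys = refl
  any-++ (x ∷ xs) ys = trans (cong (p x ∨_) (any-++ xs ys)) (sym (∨-assoc (p x) _ _))

  all-++ : ∀ xs ys → all p (xs ++ ys) ≡ all p xs ∧ all p ys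
  all-++ []       ys = refl
  all-++ (x ∷ xs) ys = trans (cong (p x ∧_) (all-++ xs ys)) (sym (∧-assoc (p x) _ _))

module _ {A : Set} (p : A → Bool) where

  any-all-prefix : ∀ s ts → any (all p) (map (s ++_) ts) ≡ all p s ∧ any (all p) ts
  any-all-prefix s []       = sym (∧-zeroʳ (all p s))
  any-all-prefix s (t ∷ ts) =
    trans (cong₂ _∨_ (all-++ p s t) (any-all-prefix s ts)) (sym (∧-distribˡ-∨ (all p s) (all p t) _))

  any-all-products : ∀ ss ts →
    any (all p) (concatMap (λ s → map (s ++_) ts) ss) ≡ any (all p) ss ∧ any (all p) ts
  any-all-products []       ts = refl
  any-all-products (s ∷ ss) ts =
    trans (any-++ (all p) (map (s ++_) ts) _)
      (trans (cong₂ _∨_ (any-all-prefix s ts) (any-all-products ss ts))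
        (sym (∧-distribʳ-∨ (any (all p) ts) (all p s) _)))

polarised : Bool → M → M
polarised false a = a
polarised true  a = negM a

litValue : Valuation n → Lit n → M
litValue v (x , b) = polarised b (v x)

high-dnf : ∀ (v : Valuation n) b e →
  high (polarised b (⟦ e ⟧ v)) ≡ any (all (high ∘ litValue v)) (dnf b e)
high-dnf v b     (var x)  = sym (trans (∨-identityʳ _) (∧-identityʳ _))
high-dnf v false (¬ₑ e)   = high-dnf v true e
high-dnf v true  (¬ₑ e)   = trans (cong high (negM-involutive (⟦ e ⟧ v))) (high-dnf v false e)
high-dnf v false (e ∧ₑ f) =
  trans (high-minM (⟦ e ⟧ v) (⟦ f ⟧ v))
    (trans (cong₂ _∧_ (high-dnf v false e) (high-dnf v false f))
      (sym (any-all-products (high ∘ litValue v) (dnf false e) (dnf false f))))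
high-dnf v true  (e ∧ₑ f) =
  trans (low-minM (⟦ e ⟧ v) (⟦ f ⟧ v))
    (trans (cong₂ _∨_ (high-dnf v true e) (high-dnf v true f))
      (sym (any-++ (all (high ∘ litValue v)) (dnf true e) (dnf true f))))
high-dnf v false (e ∨ₑ f) =
  trans (high-maxM (⟦ e ⟧ v) (⟦ f ⟧ v))
    (trans (cong₂ _∨_ (high-dnf v false e) (high-dnf v false f))
      (sym (any-++ (all (high ∘ litValue v)) (dnf false e) (dnf false f))))
high-dnf v true  (e ∨ₑ f) =
  trans (low-maxM (⟦ e ⟧ v) (⟦ f ⟧ v))
    (trans (cong₂ _∧_ (high-dnf v true e) (high-dnf v true f))
      (sym (any-all-products (high ∘ litValue v) (dnf true e) (dnf true f))))

≡ᵇLit⇒≡ : ∀ (l l′ : Lit n) → T (l ≡ᵇLit l′) → l ≡ l′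
≡ᵇLit⇒≡ (x , false) (y , false) h = cong (_, false) (toℕ-injective (≡ᵇ⇒≡ _ _ (subst T (∧-identityʳ _) h)))
≡ᵇLit⇒≡ (x , true)  (y , true)  h = cong (_, true) (toℕ-injective (≡ᵇ⇒≡ _ _ (subst T (∧-identityʳ _) h)))
≡ᵇLit⇒≡ (x , false) (y , true)  h = ⊥-elim (subst T (∧-zeroʳ _) h)
≡ᵇLit⇒≡ (x , true)  (y , false) h = ⊥-elim (subst T (∧-zeroʳ _) h)

≡ᵇLit-refl : ∀ (l : Lit n) → T (l ≡ᵇLit l)
≡ᵇLit-refl (x , false) = subst T (sym (∧-identityʳ _)) (≡⇒≡ᵇ (toℕ x) (toℕ x) refl)
≡ᵇLit-refl (x , true)  = subst T (sym (∧-identityʳ _)) (≡⇒≡ᵇ (toℕ x) (toℕ x) refl)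

elemᵇ⇒∈ : ∀ (l : Lit n) t → T (elemᵇ l t) → l ∈ t
elemᵇ⇒∈ l t h = Any.map (λ {l′} → ≡ᵇLit⇒≡ l l′) (any⁻ _ t h)

∈⇒elemᵇ : ∀ {l : Lit n} {t} → l ∈ t → T (elemᵇ l t)
∈⇒elemᵇ {l = l} l∈t = any⁺ _ (Any.map (λ { refl → ≡ᵇLit-refl l }) l∈t)

subᵇ⇒⊆ : ∀ (s t : Term n) → T (subᵇ s t) → s ⊆ t
subᵇ⇒⊆ s t h = elemᵇ⇒∈ _ t ∘ All.lookup (all⁺ _ s h)

⊆⇒subᵇ : ∀ {s t : Term n} → s ⊆ t → T (subᵇ s t)
⊆⇒subᵇ s⊆t = all⁻ _ (All.tabulate (∈⇒elemᵇ ∘ s⊆t))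

∈-complement⇒contrᵇ : ∀ {t : Term n} {x b} → (x , b) ∈ t → (x , not b) ∈ t → T (contrᵇ t)
∈-complement⇒contrᵇ {t = t} {x} {b} l∈t l̄∈t = any⁺ _ (lose l∈t (∈⇒elemᵇ {l = x , not b} {t} l̄∈t))

contrᵇ-mono : ∀ {s t : Term n} → s ⊆ t → T (contrᵇ s) → T (contrᵇ t)
contrᵇ-mono {s = s} s⊆t h with find (any⁻ _ s h)
... | (x , b) , l∈s , l̄∈s = ∈-complement⇒contrᵇ (s⊆t l∈s) (s⊆t (elemᵇ⇒∈ (x , not b) s l̄∈s))

nubLit-⊆ : ∀ (t : Term n) → nubLit t ⊆ t
nubLit-⊆ (l ∷ t) l′∈ with elemᵇ l t
nubLit-⊆ (l ∷ t) l′∈          | true  = there (nubLit-⊆ t l′∈)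
nubLit-⊆ (l ∷ t) (here refl)  | false = here refl
nubLit-⊆ (l ∷ t) (there l′∈)  | false = there (nubLit-⊆ t l′∈)

⊆-nubLit : ∀ (t : Term n) → t ⊆ nubLit t
⊆-nubLit (l ∷ t) l′∈ with elemᵇ l t in l∈?
⊆-nubLit (l ∷ t) (here refl)  | true  = ⊆-nubLit t (elemᵇ⇒∈ l t (subst T (sym l∈?) _))
⊆-nubLit (l ∷ t) (there l′∈)  | true  = ⊆-nubLit t l′∈
⊆-nubLit (l ∷ t) (here refl)  | false = here refl
⊆-nubLit (l ∷ t) (there l′∈)  | false = there (⊆-nubLit t l′∈)

nubTerm-⊆ : ∀ (d : DNF n) → nubTerm d ⊆ d
nubTerm-⊆ (t ∷ d) u∈ with any (sameᵇ t) d
nubTerm-⊆ (t ∷ d) u∈          | true  = there (nubTerm-⊆ d u∈)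
nubTerm-⊆ (t ∷ d) (here refl) | false = here refl
nubTerm-⊆ (t ∷ d) (there u∈)  | false = there (nubTerm-⊆ d u∈)

nubTerm-below : ∀ (d : DNF n) {u} → u ∈ d → ∃[ w ] w ∈ nubTerm d × w ⊆ u
nubTerm-below (t ∷ d) u∈ with any (sameᵇ t) d in dup
nubTerm-below (t ∷ d) (here refl) | true with find (any⁻ _ d (subst T (sym dup) _))
... | w , w∈d , t≈w with nubTerm-below d w∈d
... | w′ , w′∈ , w′⊆w = w′ , w′∈ , ⊆-trans w′⊆w (subᵇ⇒⊆ w t (proj₂ (Equivalence.to T-∧ t≈w)))
nubTerm-below (t ∷ d) (there u∈)  | true  = nubTerm-below d u∈
nubTerm-below (t ∷ d) (here refl) | false = t , here refl , ⊆-refl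
nubTerm-below (t ∷ d) (there u∈)  | false with nubTerm-below d u∈
... | w , w∈ , w⊆u = w , there w∈ , w⊆u

module _ {A : Set} (_≺_ : A → A → Bool)
         (≺-irrefl : ∀ x → ¬ T (x ≺ x))
         (≺-trans : ∀ x y z → T (x ≺ y) → T (y ≺ z) → T (x ≺ z)) where

  minimal-∷ : ∀ x xs → ∃[ m ] m ∈ x ∷ xs × (∀ {w} → w ∈ x ∷ xs → ¬ T (w ≺ m))
  minimal-∷ x [] = x , here refl , λ { (here refl) → ≺-irrefl x }
  minimal-∷ x (y ∷ ys) with minimal-∷ y ys
  ... | m , m∈ , m-min with T? (x ≺ m)
  ...   | yes x≺m = x , here refl , λ { (here refl) → ≺-irrefl x
                                      ; {w} (there w∈) w≺x → m-min w∈ (≺-trans w x m w≺x x≺m) }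
  ...   | no  x⊀m = m , there m∈ , λ { (here refl) → x⊀m ; (there w∈) → m-min w∈ }

  minimal : ∀ {y xs} → y ∈ xs → ∃[ m ] m ∈ xs × (∀ {w} → w ∈ xs → ¬ T (w ≺ m))
  minimal {xs = x ∷ xs} _ = minimal-∷ x xs

_⊂ᵇ_ : Term n → Term n → Bool
s ⊂ᵇ t = subᵇ s t ∧ not (subᵇ t s)

⊂ᵇ⇒⊂ : ∀ (s t : Term n) → T (s ⊂ᵇ t) → s ⊆ t × ¬ (t ⊆ s)
⊂ᵇ⇒⊂ s t h with Equivalence.to T-∧ h
... | s⊆t , t⊈s = subᵇ⇒⊆ s t s⊆t , Equivalence.to T-not t⊈s ∘ ⊆⇒subᵇ

⊂⇒⊂ᵇ : ∀ {s t : Term n} → s ⊆ t → ¬ (t ⊆ s) → T (s ⊂ᵇ t)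
⊂⇒⊂ᵇ {s = s} {t} s⊆t t⊈s = Equivalence.from T-∧ (⊆⇒subᵇ s⊆t , Equivalence.from T-not (t⊈s ∘ subᵇ⇒⊆ t s))

⊂ᵇ-irrefl : ∀ (t : Term n) → ¬ T (t ⊂ᵇ t)
⊂ᵇ-irrefl t h = proj₂ (⊂ᵇ⇒⊂ t t h) ⊆-refl

⊂ᵇ-trans : ∀ (s t u : Term n) → T (s ⊂ᵇ t) → T (t ⊂ᵇ u) → T (s ⊂ᵇ u)
⊂ᵇ-trans s t u s⊂t t⊂u with ⊂ᵇ⇒⊂ s t s⊂t | ⊂ᵇ⇒⊂ t u t⊂u
... | s⊆t , t⊈s | t⊆u , _ = ⊂⇒⊂ᵇ (⊆-trans s⊆t t⊆u) (λ u⊆s → t⊈s (⊆-trans t⊆u u⊆s))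

-- A ⊆-minimal term of d below u survives absorption.
absorb-below : ∀ (d : DNF n) {u} → u ∈ d → ∃[ w ] w ∈ absorb d × w ⊆ u
absorb-below d {u} u∈d
  with minimal _⊂ᵇ_ ⊂ᵇ-irrefl ⊂ᵇ-trans (∈-filter⁺ (λ w → T? (subᵇ w u)) u∈d (⊆⇒subᵇ {s = u} {u} ⊆-refl))
... | m , m∈below , m-min = m , ∈-filter⁺ (λ t → T? (not (any (_⊂ᵇ t) d))) m∈d unabsorbed , subᵇ⇒⊆ m u m⊆u
  where
  m∈d : m ∈ d
  m∈d = proj₁ (∈-filter⁻ (λ w → T? (subᵇ w u)) {xs = d} m∈below)
  m⊆u : T (subᵇ m u)
  m⊆u = proj₂ (∈-filter⁻ (λ w → T? (subᵇ w u)) {xs = d} m∈below)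

  unabsorbed : T (not (any (_⊂ᵇ m) d))
  unabsorbed = Equivalence.from T-not λ h → let s , s∈d , s⊂m = find (any⁻ _ d h) in
    m-min (∈-filter⁺ (λ w → T? (subᵇ w u)) s∈d
            (⊆⇒subᵇ {s = s} (⊆-trans (proj₁ (⊂ᵇ⇒⊂ s m s⊂m)) (subᵇ⇒⊆ m u m⊆u)))) s⊂m

𝓜-term-above-dnf : ∀ (φ : Expr n) {γ} → γ ∈ 𝓜 φ → ∃[ t ] t ∈ dnf false φ × t ⊆ γ
𝓜-term-above-dnf φ γ∈ with ∈-map⁻ nubLit (nubTerm-⊆ (map nubLit (dnf false φ)) (proj₁ (∈-filter⁻ _ γ∈)))
... | t , t∈ , refl = t , t∈ , ⊆-nubLit t

𝓜-term-below-dnf : ∀ (φ : Expr n) {t} → t ∈ dnf false φ → ∃[ δ ] δ ∈ 𝓜 φ × δ ⊆ t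
𝓜-term-below-dnf φ {t} t∈ =
  let w , w∈ , w⊆t = nubTerm-below (map nubLit (dnf false φ)) (∈-map⁺ nubLit t∈)
      δ , δ∈ , δ⊆w = absorb-below (nubTerm (map nubLit (dnf false φ))) w∈
  in  δ , δ∈ , ⊆-trans δ⊆w (⊆-trans w⊆t (nubLit-⊆ t))

indicator : Bool → Bool → M
indicator true  _     = pos 1
indicator false true  = neg 1
indicator false false = pos 0

high-indicator : ∀ a b → high (indicator a b) ≡ a
high-indicator true  _     = refl
high-indicator false true  = refl
high-indicator false false = refl

low-indicator : ∀ a b → (T a → ¬ T b) → low (indicator a b) ≡ b
low-indicator true  false _      = refl
low-indicator true  true  a⇒¬b = ⊥-elim (a⇒¬b _ _)
low-indicator false true  _      = refl
low-indicator false false _      = refl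

valuationOf : Term n → Valuation n
valuationOf γ x = indicator (elemᵇ (x , false) γ) (elemᵇ (x , true) γ)

module _ (γ : Term n) (γ-consistent : ¬ T (contrᵇ γ)) where

  high-litValue : ∀ l → high (litValue (valuationOf γ) l) ≡ elemᵇ l γ
  high-litValue (x , false) = high-indicator _ _
  high-litValue (x , true)  = low-indicator _ _ λ x∈γ x̄∈γ →
    γ-consistent (∈-complement⇒contrᵇ (elemᵇ⇒∈ (x , false) γ x∈γ) (elemᵇ⇒∈ (x , true) γ x̄∈γ))

  high-⟦⟧-valuationOf : ∀ φ → high (⟦ φ ⟧ valuationOf γ) ≡ any (λ t → subᵇ t γ) (dnf false φ)
  high-⟦⟧-valuationOf φ =
    trans (high-dnf (valuationOf γ) false φ)
      (cong or (map-cong (λ t → cong and (map-cong high-litValue t)) (dnf false φ)))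

  high⇔dnf-term-⊆ : ∀ φ → T (high (⟦ φ ⟧ valuationOf γ)) ⇔ (∃[ t ] t ∈ dnf false φ × t ⊆ γ)
  high⇔dnf-term-⊆ φ = mk⇔
    (λ h → let t , t∈ , t⊆γ = find (any⁻ (λ t → subᵇ t γ) (dnf false φ) (subst T (high-⟦⟧-valuationOf φ) h))
           in  t , t∈ , λ {l} → subᵇ⇒⊆ t γ t⊆γ {l})
    (λ (t , t∈ , t⊆γ) → subst T (sym (high-⟦⟧-valuationOf φ)) (any⁺ _ (lose t∈ (⊆⇒subᵇ t⊆γ))))

∈𝓜imp⁻ : ∀ (φ : Expr n) {γ} → γ ∈ 𝓜imp φ → γ ∈ 𝓜 φ × ¬ T (contrᵇ γ)
∈𝓜imp⁻ φ γ∈ with ∈-filter⁻ (λ t → T? (not (contrᵇ t))) {xs = 𝓜 φ} γ∈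
... | γ∈𝓜 , γ-consistent = γ∈𝓜 , Equivalence.to T-not γ-consistent

∈𝓜imp⁺ : ∀ (φ : Expr n) {δ} → δ ∈ 𝓜 φ → ¬ T (contrᵇ δ) → δ ∈ 𝓜imp φ
∈𝓜imp⁺ φ δ∈ δ-consistent =
  ∈-filter⁺ (λ t → T? (not (contrᵇ t))) {xs = 𝓜 φ} δ∈ (Equivalence.from T-not δ-consistent)

lemma2 : (n : ℕ) (φ ψ : Expr n) (γ : Term n) → γ ∈ 𝓜imp φ →
    (∀ (δ : Term n) → δ ∈ 𝓜imp ψ → ¬ (δ ⊆ γ)) →
    Σ (Valuation n) (λ v → Positive (⟦ φ ⟧ v) × (⟦ ψ ⟧ v <M ⟦ φ ⟧ v))
lemma2 n φ ψ γ γ∈𝓜imp no-imp-below = valuationOf γ , high⇒Positive φ-high , ¬high<high ψ-not-high φ-high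
  where
  γ∈𝓜 : γ ∈ 𝓜 φ
  γ∈𝓜 = proj₁ (∈𝓜imp⁻ φ γ∈𝓜imp)

  γ-consistent : ¬ T (contrᵇ γ)
  γ-consistent = proj₂ (∈𝓜imp⁻ φ γ∈𝓜imp)

  φ-high : T (high (⟦ φ ⟧ valuationOf γ))
  φ-high = Equivalence.from (high⇔dnf-term-⊆ γ γ-consistent φ) (𝓜-term-above-dnf φ γ∈𝓜)

  ψ-not-high : ¬ T (high (⟦ ψ ⟧ valuationOf γ))
  ψ-not-high h =
    let t , t∈ , t⊆γ = Equivalence.to (high⇔dnf-term-⊆ γ γ-consistent ψ) h
        δ , δ∈𝓜 , δ⊆t = 𝓜-term-below-dnf ψ t∈
        δ⊆γ = ⊆-trans δ⊆t t⊆γ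
    in  no-imp-below δ (∈𝓜imp⁺ ψ δ∈𝓜 (γ-consistent ∘ contrᵇ-mono δ⊆γ)) δ⊆γ
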